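{- Let $c$ be a configuration of size $n$ with left-to-right order $u_1\le u_2\le\dots\le u_n$. Then $c$ is weakly Łukasiewicz if and only if $u_j\le\max(u_{j-1}+1,\,j)$ for all $j\in[2;n]$.
   Context: A configuration of size $n$ is a tuple $c=(c_1,\dots,c_n)$ of nonnegative integers with $\sum_i c_i=n$, viewed as $c_i$ balls at site $i\in\mathbb{Z}$; its left-to-right order is the non-decreasing sequence $u_1\le\dots\le u_n$ in which each $i\in[1;n]$ appears $c_i$ times. Fix real $q>0$. Random dynamic: balls are dropped onto $\mathbb{Z}$ one at a time from their sites; a ball landing on an occupied site moves one site left with probability $q/(1+q)$ and right with probability $1/(1+q)$, repeating until it reaches an unoccupied site, where it settles. A configuration $c$ is weakly Łukasiewicz if, when its balls are dropped in left-to-right order, in every run of the dynamic (with positive probability) in which all balls end in $[1;n]$, the set of occupied sites after each ball has settled is an interval. -}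

module Defs where

open import Data.Nat using (ℕ; zero; suc; _≤_; _⊔_; _+_; _∸_)
open import Data.Integer as ℤ using (ℤ; +_)
open import Data.List using (List; []; _∷_; _++_; replicate; take)
open import Data.List.Membership.Propositional using (_∈_; _∉_)
open import Data.List.Relation.Unary.All using (All)
open import Data.Vec using (Vec; toList; sum)
open import Data.Product using (_×_)
open import Relation.Binary.PropositionalEquality using (_≡_)

record Configuration (n : ℕ) : Set where
  constructor config
  field
    balls   : Vec ℕ n
    sumIsN  : sum balls ≡ n

ltrFrom : ℕ → List ℕ → List ℕ
ltrFrom i []       = []
ltrFrom i (c ∷ cs) = replicate c i ++ ltrFrom (suc i) cs

leftToRight : ∀ {n} → Configuration n → List ℕ
leftToRight c = ltrFrom 1 (toList (Configuration.balls c))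

-- 1-indexed access u_j (default 0 out of range; only used for j ∈ [1;length])
at : List ℕ → ℕ → ℕ
at []       _             = 0
at (x ∷ xs) zero          = 0
at (x ∷ xs) (suc zero)    = x
at (x ∷ xs) (suc (suc k)) = at xs (suc k)

-- One ball dropped at site u onto occupied set S settles at site v, along some
-- finite walk: while on an occupied site it moves left or right (both
-- possibilities have positive probability since q > 0); it stops at the first
-- unoccupied site.
data Drop (S : List ℤ) : ℤ → ℤ → Set where
  settle : ∀ {u} → u ∉ S → Drop S u u
  left   : ∀ {u v} → u ∈ S → Drop S (u ℤ.- + 1) v → Drop S u v
  right  : ∀ {u v} → u ∈ S → Drop S (u ℤ.+ + 1) v → Drop S u v

data Run (S : List ℤ) : List ℕ → List ℤ → Set where
  done : Run S [] []
  step : ∀ {u us v vs} → Drop S (+ u) v → Run (v ∷ S) us vs → Run S (u ∷ us) (v ∷ vs)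

IsInterval : List ℤ → Set
IsInterval S = ∀ {a b x} → a ∈ S → b ∈ S → a ℤ.≤ x → x ℤ.≤ b → x ∈ S

InRange : ℕ → ℤ → Set
InRange n v = (+ 1 ℤ.≤ v) × (v ℤ.≤ + n)

-- weakly Łukasiewicz: dropping balls in left-to-right order, in every run in
-- which all balls end in [1;n], the occupied set after each ball has settled
-- (the first k settled sites) is an interval.
WeaklyLukasiewicz : ∀ {n} → Configuration n → Set
WeaklyLukasiewicz {n} c =
  ∀ (vs : List ℤ) → Run [] (leftToRight c) vs → All (InRange n) vs →
  ∀ (k : ℕ) → 1 ≤ k → IsInterval (take k vs)

{-# OPTIONS --safe #-}

-- If u_j > max(u_{j-1} + 1, j), let m = max(u_{j-1}, j - 1): the first j - 1 balls start in [1; m]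
-- and there are at most m of them, so each can walk to a free site of [1; m]; ball j then settles on
-- its own free site u_j ≥ m + 2 and the remaining balls fit in [1; n]. After j balls, m + 1 is a hole.
-- Conversely, if the bound holds then after i balls the occupied sites form a block [a + 1; a + i]
-- containing u_i, and u_i ≤ u_{i+1} ≤ max(u_i + 1, i + 1) ≤ a + i + 1. A ball started inside the
-- block leaves it at one of its ends, one started just right of it stays there; either way the block
-- grows by one site and contains u_{i+1}.
module Submission where

open import Defs
open import Data.Nat
  using ( ℕ; zero; suc; _≤_; _<_; _⊔_; _+_; _∸_; _≤?_; z≤n; s≤s
        ; _≤′_; ≤′-refl; ≤′-step; _≤‴_; ≤‴-refl; ≤‴-step)
open import Data.Nat.Properties
open import Data.Integer as ℤ using (ℤ; +_; +≤+)
import Data.Integer.Properties as ℤₚ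
open import Data.List
  using (List; []; _∷_; _++_; [_]; replicate; take; drop; length; reverse; _ʳ++_; filter)
open import Data.List.Properties
  using (length-++; length-replicate; length-take; length-reverse; take-[]; filter-notAll)
open import Data.List.Membership.Propositional using (_∈_; _∉_)
open import Data.List.Membership.Propositional.Properties using (∈-++⁺ʳ; ∈-++⁻; ∈-filter⁺)
open import Data.List.Membership.DecPropositional ℤ._≟_ using (_∈?_)
open import Data.List.Relation.Unary.All as All using (All; []; _∷_)
open import Data.List.Relation.Unary.All.Properties using (++⁺; ++⁻ʳ; take⁺; replicate⁺)
open import Data.List.Relation.Unary.Any as Any using (here; there)
import Data.List.Relation.Unary.Linked as Linked
open Linked using (Linked; [-]; _∷_)
open import Data.List.Relation.Binary.Permutation.Propositional using (_↭_; ↭-sym)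
open import Data.List.Relation.Binary.Permutation.Propositional.Properties using (∈-resp-↭; ↭-reverse)
open import Data.Vec as Vec using (Vec; toList)
open import Data.Vec.Properties using (length-toList)
open import Data.Product using (_×_; _,_; proj₁; proj₂; ∃-syntax)
open import Data.Sum using (_⊎_; inj₁; inj₂)
open import Data.Empty using (⊥-elim)
open import Function.Bundles using (_⇔_; mk⇔)
open import Relation.Nullary using (¬_; yes; no; ¬?)
open import Relation.Binary.PropositionalEquality using (_≡_; _≢_; refl; sym; trans; cong; cong₂; subst)

Between : ℕ → ℕ → ℤ → Set
Between lo hi x = + lo ℤ.≤ x × x ℤ.≤ + hi

InRangeℕ : ℕ → ℕ → Set
InRangeℕ m u = 1 ≤ u × u ≤ m

drop-from-free : ∀ {S w v} → w ∉ S → Drop S w v → v ≡ w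
drop-from-free _  (settle _)   = refl
drop-from-free w∉ (left w∈ _)  = ⊥-elim (w∉ w∈)
drop-from-free w∉ (right w∈ _) = ⊥-elim (w∉ w∈)

drop-leftward : ∀ {S x u} → + x ∉ S → x ≤′ u → ∃[ v ] Drop S (+ u) v × Between x u v
drop-leftward x∉ ≤′-refl = _ , settle x∉ , ℤₚ.≤-refl , ℤₚ.≤-refl
drop-leftward {S} {u = suc u} x∉ (≤′-step x≤′u) with + suc u ∈? S
... | no u∉ = _ , settle u∉ , +≤+ (≤′⇒≤ (≤′-step x≤′u)) , ℤₚ.≤-refl
... | yes u∈ with drop-leftward x∉ x≤′u
...   | v , d , x≤v , v≤u = v , left u∈ d , x≤v , ℤₚ.≤-trans v≤u (+≤+ (n≤1+n u))

drop-rightward : ∀ {S x u} → + x ∉ S → u ≤‴ x → ∃[ v ] Drop S (+ u) v × Between u x v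
drop-rightward x∉ ≤‴-refl = _ , settle x∉ , ℤₚ.≤-refl , ℤₚ.≤-refl
drop-rightward {S} {u = u} x∉ (≤‴-step u<‴x) with + u ∈? S
... | no u∉ = _ , settle u∉ , ℤₚ.≤-refl , +≤+ (≤‴⇒≤ (≤‴-step u<‴x))
... | yes u∈ with drop-rightward x∉ u<‴x
...   | v , d , u<v , v≤x =
  v , right u∈ (subst (λ w → Drop S w v) (cong +_ (+-comm 1 u)) d) , ℤₚ.≤-trans (+≤+ (n≤1+n u)) u<v , v≤x

drop-into-range : ∀ {S m x u} → + x ∉ S → InRangeℕ m x → InRangeℕ m u →
                  ∃[ v ] Drop S (+ u) v × InRange m v
drop-into-range {x = x} {u} x∉ (1≤x , x≤m) (1≤u , u≤m) with x ≤? u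
... | yes x≤u with drop-leftward x∉ (≤⇒≤′ x≤u)
...   | v , d , x≤v , v≤u = v , d , ℤₚ.≤-trans (+≤+ 1≤x) x≤v , ℤₚ.≤-trans v≤u (+≤+ u≤m)
drop-into-range {x = x} {u} x∉ (1≤x , x≤m) (1≤u , u≤m) | no x≰u
  with drop-rightward x∉ (≤⇒≤‴ (<⇒≤ (≰⇒> x≰u)))
...   | v , d , u≤v , v≤x = v , d , ℤₚ.≤-trans (+≤+ 1≤u) u≤v , ℤₚ.≤-trans v≤x (+≤+ x≤m)

free-site : ∀ m (S : List ℤ) → length S < m → ∃[ x ] InRangeℕ m x × + x ∉ S
free-site (suc m) S |S|≤m with + suc m ∈? S
... | no m+1∉ = suc m , (s≤s z≤n , ≤-refl) , m+1∉
... | yes m+1∈ with free-site m (filter (λ s → ¬? (s ℤ.≟ + suc m)) S)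
                      (<-≤-trans (filter-notAll _ S (Any.map (λ eq ne → ne (sym eq)) m+1∈)) (≤-pred |S|≤m))
...   | x , (1≤x , x≤m) , x∉ = x , (1≤x , m≤n⇒m≤1+n x≤m) , λ x∈ → x∉ (∈-filter⁺ _ x∈ (x≢m+1 x≤m))
  where
  x≢m+1 : ∀ {x} → x ≤ m → + x ≢ + suc m
  x≢m+1 x≤m eq = 1+n≰n (subst (_≤ m) (ℤₚ.+-injective eq) x≤m)

run-within : ∀ {m} S us → length S + length us ≤ m → All (InRangeℕ m) us →
             ∃[ vs ] Run S us vs × All (InRange m) vs
run-within S [] _ [] = [] , done , []
run-within {m} S (u ∷ us) fits (u∈ ∷ us∈) with free-site m S (<-≤-trans (m<m+n (length S) (s≤s z≤n)) fits)
... | x , x∈ , x∉ with drop-into-range x∉ x∈ u∈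
...   | v , d , v∈ with run-within (v ∷ S) us (subst (_≤ m) (+-suc (length S) (length us)) fits) us∈
...     | vs , r , vs∈ = v ∷ vs , step d r , v∈ ∷ vs∈

run-++ : ∀ {S us₁ us₂ vs₁ vs₂} → Run S us₁ vs₁ → Run (vs₁ ʳ++ S) us₂ vs₂ → Run S (us₁ ++ us₂) (vs₁ ++ vs₂)
run-++ done        r₂ = r₂
run-++ (step d r₁) r₂ = step d (run-++ r₁ r₂)

run-length : ∀ {S us vs} → Run S us vs → length vs ≡ length us
run-length done       = refl
run-length (step _ r) = cong suc (run-length r)

record Occupies (S : List ℤ) (lo hi : ℕ) : Set where
  field
    within : ∀ {x} → x ∈ S → Between lo hi x
    covers : ∀ {x} → Between lo hi x → x ∈ S
open Occupies

occupies-[] : ∀ a → Occupies [] (suc a) a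
occupies-[] a .within ()
occupies-[] a .covers (a<x , x≤a) = ⊥-elim (1+n≰n (ℤₚ.drop‿+≤+ (ℤₚ.≤-trans a<x x≤a)))

occupies⇒interval : ∀ {S lo hi} → Occupies S lo hi → IsInterval S
occupies⇒interval occ a∈ b∈ a≤x x≤b =
  occ .covers (ℤₚ.≤-trans (proj₁ (occ .within a∈)) a≤x , ℤₚ.≤-trans x≤b (proj₂ (occ .within b∈)))

occupies-extendʳ : ∀ {S lo hi} → Occupies S lo hi → lo ≤ suc hi → Occupies (+ suc hi ∷ S) lo (suc hi)
occupies-extendʳ occ lo≤ .within (here refl) = +≤+ lo≤ , ℤₚ.≤-refl
occupies-extendʳ {hi = hi} occ _ .within (there x∈) =
  proj₁ (occ .within x∈) , ℤₚ.≤-trans (proj₂ (occ .within x∈)) (+≤+ (n≤1+n hi))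
occupies-extendʳ occ _ .covers (lo≤k@(+≤+ _) , +≤+ k≤hi+1) with m≤n⇒m<n∨m≡n k≤hi+1
... | inj₂ refl       = here refl
... | inj₁ (s≤s k≤hi) = there (occ .covers (lo≤k , +≤+ k≤hi))

occupies-extendˡ : ∀ {S lo hi} → Occupies S (suc lo) hi → lo ≤ hi → Occupies (+ lo ∷ S) lo hi
occupies-extendˡ occ lo≤hi .within (here refl) = ℤₚ.≤-refl , +≤+ lo≤hi
occupies-extendˡ {lo = lo} occ _ .within (there x∈) =
  ℤₚ.≤-trans (+≤+ (n≤1+n lo)) (proj₁ (occ .within x∈)) , proj₂ (occ .within x∈)
occupies-extendˡ occ _ .covers (+≤+ lo≤k , k≤hi) with m≤n⇒m<n∨m≡n lo≤k
... | inj₂ refl = here refl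
... | inj₁ lo<k = there (occ .covers (+≤+ lo<k , k≤hi))

-- Allowing the start to be one of the two free neighbours of the block makes the induction go through.
drop-leaves-block : ∀ {S a i w v} → Occupies S (suc a) (i + a) → Between a (suc (i + a)) w →
                    Drop S w v → v ≡ + a ⊎ v ≡ + suc (i + a)
drop-leaves-block occ (+≤+ a≤k , +≤+ k≤) (settle k∉) with m≤n⇒m<n∨m≡n a≤k | m≤n⇒m<n∨m≡n k≤
... | inj₂ refl | _               = inj₁ refl
... | inj₁ _    | inj₂ refl       = inj₂ refl
... | inj₁ a<k  | inj₁ (s≤s k≤hi) = ⊥-elim (k∉ (occ .covers (+≤+ a<k , +≤+ k≤hi)))
drop-leaves-block occ (_ , w≤) (left w∈ d) with occ .within w∈
... | +≤+ (s≤s a≤k′) , _ = drop-leaves-block occ (+≤+ a≤k′ , ℤₚ.≤-trans (+≤+ (n≤1+n _)) w≤) d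
drop-leaves-block {a = a} {i} occ (+≤+ a≤k , _) (right w∈ d) with occ .within w∈
... | _ , +≤+ {m = k} k≤hi =
  drop-leaves-block occ (+≤+ (m≤n⇒m≤n+o 1 a≤k) , +≤+ (subst (_≤ suc (i + a)) (+-comm 1 k) (s≤s k≤hi))) d

drop-grows-block : ∀ {S a i q v} → Occupies S (suc a) (i + a) → a < q → q ≤ suc (i + a) →
                   Drop S (+ q) v → + 1 ℤ.≤ v →
                   ∃[ a′ ] Occupies (v ∷ S) (suc a′) (suc i + a′) × a′ < q × q ≤ suc i + a′
drop-grows-block {S} {a} {i} {q} occ a<q q≤ d 1≤v with drop-leaves-block occ (+≤+ (<⇒≤ a<q) , +≤+ q≤) d
... | inj₂ refl = a , occupies-extendʳ occ (s≤s (m≤n+m a i)) , a<q , q≤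
... | inj₁ refl with m≤n⇒m<n∨m≡n q≤ | 1≤v
...   | inj₂ refl | _ = ⊥-elim (1+n≰n (subst (_≤ i + a) (ℤₚ.+-injective (drop-from-free q∉ d)) (m≤n+m a i)))
  where
  q∉ : + suc (i + a) ∉ S
  q∉ q∈ = 1+n≰n (ℤₚ.drop‿+≤+ (proj₂ (occ .within q∈)))
...   | inj₁ (s≤s q≤hi) | +≤+ (s≤s {n = a′} z≤n) =
  a′ , subst (Occupies _ (suc a′)) (+-suc i a′) (occupies-extendˡ occ (m≤n+m (suc a′) i)) ,
  <⇒≤ a<q , subst (q ≤_) (+-suc i a′) q≤hi

interval-resp-↭ : ∀ {S T} → S ↭ T → IsInterval S → IsInterval T
interval-resp-↭ S↭T interval a∈ b∈ a≤x x≤b =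
  ∈-resp-↭ S↭T (interval (∈-resp-↭ (↭-sym S↭T) a∈) (∈-resp-↭ (↭-sym S↭T) b∈) a≤x x≤b)

WeaklyLukasiewiczOrder : ℕ → List ℕ → Set
WeaklyLukasiewiczOrder n us =
  ∀ (vs : List ℤ) → Run [] us vs → All (InRange n) vs → ∀ (k : ℕ) → 1 ≤ k → IsInterval (take k vs)

-- i counts the balls dropped before us: the j-th entry of us is ball i + j.
StepBounded : ℕ → ℕ → List ℕ → Set
StepBounded i len us = ∀ j → 2 ≤ j → j ≤ len → at us j ≤ (at us (j ∸ 1) + 1) ⊔ (i + j)

StepBounded-tail : ∀ {i len x us} → StepBounded i (suc len) (x ∷ us) → StepBounded (suc i) len us
StepBounded-tail _ 1 (s≤s ()) _
StepBounded-tail {i} {us = us} bounded (suc (suc j)) _ j≤len =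
  subst (λ t → at us (suc (suc j)) ≤ (at us (suc j) + 1) ⊔ t) (+-suc i (suc (suc j)))
        (bounded (suc (suc (suc j))) (s≤s (s≤s z≤n)) (s≤s j≤len))

next-start-bound : ∀ {i a q q′} → q ≤ suc i + a → q′ ≤ (q + 1) ⊔ (i + 2) → q′ ≤ suc (suc i + a)
next-start-bound {i} {a} {q} q≤ q′≤ = ≤-trans q′≤ (⊔-lub
  (subst (_≤ suc (suc i + a)) (+-comm 1 q) (s≤s q≤))
  (subst (_≤ suc (suc i + a)) (+-comm 2 i) (s≤s (s≤s (m≤m+n i a)))))

-- take k vs ʳ++ S is the set of occupied sites after k more balls.
block-prefixes-intervals : ∀ {n len S a i q us vs} → Run S (q ∷ us) vs →
  Occupies S (suc a) (i + a) → a < q → q ≤ suc (i + a) →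
  Linked _≤_ (q ∷ us) → StepBounded i len (q ∷ us) → length (q ∷ us) ≤ len →
  All (InRange n) vs → ∀ k → IsInterval (take k vs ʳ++ S)
block-prefixes-intervals _ occ _ _ _ _ _ _ zero = occupies⇒interval occ
block-prefixes-intervals {us = []} (step d done) occ a<q q≤ _ _ _ (v∈ ∷ []) (suc k)
  with drop-grows-block occ a<q q≤ d (proj₁ v∈)
... | _ , occ′ , _ = subst (λ t → IsInterval (t ʳ++ _)) (sym (take-[] k)) (occupies⇒interval occ′)
block-prefixes-intervals {us = _ ∷ _} (step d r) occ a<q q≤ (q≤q′ ∷ sorted) bounded (s≤s fits)
                         (v∈ ∷ vs∈) (suc k)
  with drop-grows-block occ a<q q≤ d (proj₁ v∈)
... | _ , occ′ , a′<q , q≤′ =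
  block-prefixes-intervals r occ′ (<-≤-trans a′<q q≤q′)
    (next-start-bound q≤′ (bounded 2 ≤-refl (s≤s (≤-trans (s≤s z≤n) fits))))
    sorted (StepBounded-tail bounded) fits vs∈ k

step-bounded⇒weakly-Lukasiewicz : ∀ {n len us} → Linked _≤_ us → length us ≤ len →
                                  StepBounded 0 len us → WeaklyLukasiewiczOrder n us
step-bounded⇒weakly-Lukasiewicz {us = []} _ _ _ [] done _ (suc k) _ = λ ()
step-bounded⇒weakly-Lukasiewicz {us = _ ∷ _} sorted fits bounded vs@(_ ∷ _) run@(step d _) vs∈@(v∈ ∷ _) k _
  with drop-from-free (λ ()) d | v∈
... | refl | +≤+ (s≤s {n = a} z≤n) , _ =
  interval-resp-↭ (↭-reverse (take k vs))
    (block-prefixes-intervals run (occupies-[] a) ≤-refl ≤-refl sorted bounded fits vs∈ k)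

take-++-∷ : ∀ {A : Set} (xs : List A) {y ys} → take (suc (length xs)) (xs ++ y ∷ ys) ≡ xs ++ [ y ]
take-++-∷ []       = refl
take-++-∷ (x ∷ xs) = cong (x ∷_) (take-++-∷ xs)

take-at-drop : ∀ k (us : List ℕ) → suc k ≤ length us → us ≡ take k us ++ at us (suc k) ∷ drop (suc k) us
take-at-drop zero    (u ∷ us) _       = refl
take-at-drop (suc k) (u ∷ us) (s≤s k<) = cong (u ∷_) (take-at-drop k us k<)

take-≤-at : ∀ k {us} → Linked _≤_ us → suc k ≤ length us → All (_≤ at us (suc k)) (take (suc k) us)
take-≤-at zero    {_ ∷ _}     _                  _        = ≤-refl ∷ []
take-≤-at (suc k) {_ ∷ _ ∷ _} (u≤u′ ∷ sorted) (s≤s k<) =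
  let prefix≤ = take-≤-at k sorted k< in ≤-trans u≤u′ (All.head prefix≤) ∷ prefix≤

¬interval-with-gap : ∀ {m y} vs → 0 < length vs → All (InRange m) vs → 2 + m ≤ y →
                     ¬ IsInterval (vs ++ [ + y ])
¬interval-with-gap {m} {y} vs@(_ ∷ _) _ vs∈ m+2≤y interval
  with ∈-++⁻ vs (interval (here refl) (∈-++⁺ʳ vs (here refl))
                         (ℤₚ.≤-trans (proj₂ (All.head vs∈)) (+≤+ (n≤1+n m)))
                         (+≤+ (≤-trans (n≤1+n (suc m)) m+2≤y)))
... | inj₁ m+1∈      = 1+n≰n (ℤₚ.drop‿+≤+ (proj₂ (All.lookup vs∈ m+1∈)))
... | inj₂ (here eq) = 1+n≰n (subst (suc (suc m) ≤_) (sym (ℤₚ.+-injective eq)) m+2≤y)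

run-through-gap : ∀ {n m y} Q R → length Q ≤ m → All (InRangeℕ m) Q → m < y →
  All (InRangeℕ n) (Q ++ y ∷ R) → length (Q ++ y ∷ R) ≤ n →
  ∃[ vs₁ ] ∃[ vs₂ ] Run [] (Q ++ y ∷ R) (vs₁ ++ + y ∷ vs₂) × length vs₁ ≡ length Q ×
                    All (InRange m) vs₁ × All (InRange n) (vs₁ ++ + y ∷ vs₂)
run-through-gap {n} {m} {y} Q R |Q|≤m Q∈ m<y us∈ |us|≤n =
  let vs₁ , run₁ , vs₁∈ = run-within [] Q |Q|≤m Q∈
      |vs₁| = run-length run₁
      y∈ = All.head (++⁻ʳ Q us∈)
      y∉ : + y ∉ reverse vs₁
      y∉ y∈vs₁ = <⇒≱ m<y (ℤₚ.drop‿+≤+ (proj₂ (All.lookup vs₁∈ (∈-resp-↭ (↭-reverse vs₁) y∈vs₁))))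
      fits = subst (λ l → suc (l + length R) ≤ n) (sym (trans (length-reverse vs₁) |vs₁|))
                   (subst (_≤ n) (trans (length-++ Q) (+-suc (length Q) (length R))) |us|≤n)
      vs₂ , run₂ , vs₂∈ = run-within (+ y ∷ reverse vs₁) R fits (All.tail (++⁻ʳ Q us∈))
      m≤n = <⇒≤ (<-≤-trans m<y (proj₂ y∈))
  in vs₁ , vs₂ , run-++ run₁ (step (settle y∉) run₂) , |vs₁| , vs₁∈ ,
     ++⁺ (All.map (λ (1≤v , v≤m) → 1≤v , ℤₚ.≤-trans v≤m (+≤+ m≤n)) vs₁∈)
         ((+≤+ (proj₁ y∈) , +≤+ (proj₂ y∈)) ∷ vs₂∈)

gap⇒¬weakly-Lukasiewicz : ∀ {n m y us} Q R → us ≡ Q ++ y ∷ R → All (InRangeℕ n) us → length us ≤ n →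
  0 < length Q → length Q ≤ m → All (InRangeℕ m) Q → 2 + m ≤ y → ¬ WeaklyLukasiewiczOrder n us
gap⇒¬weakly-Lukasiewicz {m = m} Q R refl us∈ |us|≤n 0<|Q| |Q|≤m Q∈ m+2≤y wl
  with run-through-gap Q R |Q|≤m Q∈ (≤-trans (n≤1+n (suc m)) m+2≤y) us∈ |us|≤n
... | vs₁ , _ , run , |vs₁| , vs₁∈ , vs∈ =
  ¬interval-with-gap vs₁ (subst (0 <_) (sym |vs₁|) 0<|Q|) vs₁∈ m+2≤y
    (subst IsInterval (take-++-∷ vs₁) (wl _ run vs∈ (suc (length vs₁)) (s≤s z≤n)))

weakly-Lukasiewicz⇒step-bounded : ∀ {n us} → Linked _≤_ us → All (InRangeℕ n) us → length us ≡ n →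
                                  WeaklyLukasiewiczOrder n us → StepBounded 0 n us
weakly-Lukasiewicz⇒step-bounded _ _ refl _ 1 (s≤s ()) _
weakly-Lukasiewicz⇒step-bounded {us = us} sorted us∈ refl wl (suc (suc k)) _ k+2≤n
  with at us (2 + k) ≤? (at us (suc k) + 1) ⊔ (2 + k)
... | yes bounded   = bounded
... | no unbounded = ⊥-elim (gap⇒¬weakly-Lukasiewicz Q (drop (2 + k) us) (take-at-drop (suc k) us k+2≤n)
                               us∈ ≤-refl 0<|Q| |Q|≤m Q∈ m+2≤y wl)
  where
  x = at us (suc k)
  m = x ⊔ suc k
  Q = take (suc k) us
  k+1≤n : suc k ≤ length us
  k+1≤n = ≤-trans (n≤1+n (suc k)) k+2≤n
  |Q| : length Q ≡ suc k
  |Q| = trans (length-take (suc k) us) (m≤n⇒m⊓n≡m k+1≤n)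
  0<|Q| : 0 < length Q
  0<|Q| = subst (0 <_) (sym |Q|) (s≤s z≤n)
  |Q|≤m : length Q ≤ m
  |Q|≤m = subst (_≤ m) (sym |Q|) (m≤n⊔m x (suc k))
  Q∈ : All (InRangeℕ m) Q
  Q∈ = All.zipWith (λ ((1≤u , _) , u≤x) → 1≤u , ≤-trans u≤x (m≤m⊔n x (suc k)))
         (take⁺ (suc k) us∈ , take-≤-at k sorted k+1≤n)
  m+2≤y : 2 + m ≤ at us (2 + k)
  m+2≤y = subst (λ t → suc (t ⊔ (2 + k)) ≤ at us (2 + k)) (+-comm x 1) (≰⇒> unbounded)

length-ltrFrom : ∀ i {m} (cs : Vec ℕ m) → length (ltrFrom i (toList cs)) ≡ Vec.sum cs
length-ltrFrom i Vec.[]       = refl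
length-ltrFrom i (c Vec.∷ cs) =
  trans (length-++ (replicate c i)) (cong₂ _+_ (length-replicate c) (length-ltrFrom (suc i) cs))

ltrFrom-range : ∀ i (cs : List ℕ) → All (λ u → i ≤ u × u < i + length cs) (ltrFrom i cs)
ltrFrom-range i []       = []
ltrFrom-range i (c ∷ cs) =
  ++⁺ (replicate⁺ c (≤-refl , m<m+n i (s≤s z≤n)))
      (All.map (λ {u} (i<u , u<) → <⇒≤ i<u , subst (u <_) (sym (+-suc i (length cs))) u<)
               (ltrFrom-range (suc i) cs))

ltrFrom-sorted : ∀ i cs → Linked _≤_ (i ∷ ltrFrom i cs)
ltrFrom-sorted i []       = [-]
ltrFrom-sorted i (c ∷ cs) = replicate-sorted c (lower-head (n≤1+n i) (ltrFrom-sorted (suc i) cs))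
  where
  lower-head : ∀ {x y l} → y ≤ x → Linked _≤_ (x ∷ l) → Linked _≤_ (y ∷ l)
  lower-head _   [-]         = [-]
  lower-head y≤x (x≤z ∷ l≤) = ≤-trans y≤x x≤z ∷ l≤
  replicate-sorted : ∀ c {l} → Linked _≤_ (i ∷ l) → Linked _≤_ (i ∷ replicate c i ++ l)
  replicate-sorted zero    l≤ = l≤
  replicate-sorted (suc c) l≤ = ≤-refl ∷ replicate-sorted c l≤

leftToRight-sorted : ∀ {n} (c : Configuration n) → Linked _≤_ (leftToRight c)
leftToRight-sorted (config cs _) = Linked.tail (ltrFrom-sorted 1 (toList cs))

leftToRight-range : ∀ {n} (c : Configuration n) → All (InRangeℕ n) (leftToRight c)
leftToRight-range (config cs _) =
  All.map (λ (1≤u , u≤) → 1≤u , subst (_ ≤_) (length-toList cs) (≤-pred u≤))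
          (ltrFrom-range 1 (toList cs))

length-leftToRight : ∀ {n} (c : Configuration n) → length (leftToRight c) ≡ n
length-leftToRight (config cs Σcs≡n) = trans (length-ltrFrom 1 cs) Σcs≡n

proposition5p2 : ∀ (n : ℕ) (c : Configuration n) →
    WeaklyLukasiewicz c ⇔
      (∀ (j : ℕ) → 2 ≤ j → j ≤ n →
        at (leftToRight c) j ≤ (at (leftToRight c) (j ∸ 1) + 1) ⊔ j)
proposition5p2 n c = mk⇔
  (weakly-Lukasiewicz⇒step-bounded (leftToRight-sorted c) (leftToRight-range c) (length-leftToRight c))
  (step-bounded⇒weakly-Lukasiewicz (leftToRight-sorted c) (≤-reflexive (length-leftToRight c)))
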